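{- The word problem of the Behnke–Leptin C*-algebra $\mathcal A_{0,1}$ has polynomial time complexity: there exist a polynomial $T$ and a Turing machine which, on input any two formulas $\phi,\psi$, decides in fewer than $T(\|\phi\|+\|\psi\|)$ steps whether $\phi$ and $\psi$ code the same element of $E(\mathcal A_{0,1})$.
   Context: An AF algebra is the norm closure of an ascending union of finite-dimensional C*-algebras with common unit; an AF$\ell$ algebra is one whose Murray–von Neumann order of projections is a lattice, and its Elliott involutive monoid $E(\mathfrak B)$ is the set of Murray–von Neumann classes of projections with the unique total extension $\oplus$ of Elliott's partial addition and involution $[p]^*=[1-p]$ (equivalently, the unit interval $[0,u]$ of the unital $\ell$-group $K_0(\mathfrak B)$ with $x^*=u-x$, $x\oplus y=(x+y)\wedge u$). Let $M_1$ be the unital $\ell$-group of continuous piecewise linear $f:[0,1]\to\mathbb R$ with integer-coefficient linear pieces (unit the constant $1$), and $\mathfrak M_1$ (the Farey AF algebra) the unital AF algebra with $K_0(\mathfrak M_1)\cong(M_1,1)$. $E(\mathfrak M_1)$ is isomorphic to the free one-generator MV-algebra $\mathcal M_1$ of McNaughton functions ($[0,1]$-valued members of $M_1$, with $f^*=1-f$, $f\oplus g=\min(1,f+g)$), freely generated by $\mathrm{id}_{[0,1]}$; fix a projection $\mathsf p$ with $[\mathsf p]$ generating $E(\mathfrak M_1)$. Ideals of $\mathfrak M_1$ correspond bijectively to ideals of $K_0(\mathfrak M_1)=M_1$ (an ideal $\mathfrak J$ maps to its image in $K_0$). Let $J_0^+=\{f\in M_1\mid f(0)=0,\ \partial f(0)/\partial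 x^+=0\}$ (right derivative) and $\mathfrak J_0^+$ the corresponding ideal of $\mathfrak M_1$. The Behnke–Leptin algebra $\mathcal A_{0,1}$ is the AF$\ell$ algebra $\mathfrak M_1/\mathfrak J_0^+$ (equivalently, the AF algebra with $K_0\cong(\mathbb Z\times_{\mathrm{lex}}\mathbb Z,(1,0))$); $E(\mathcal A_{0,1})$ is generated by $[\mathsf p/\mathfrak J_0^+]$. Formulas are strings over $\{0,X,{}^*,\oplus,(,)\}$ built inductively: $0$, $X$ are formulas; if $\phi,\psi$ are, so are $\phi^*$ and $(\phi\oplus\psi)$. A formula codes the element of $E(\mathcal A_{0,1})$ obtained by interpreting $0$ as $0$, $X$ as $[\mathsf p/\mathfrak J_0^+]$, ${}^*$ and $\oplus$ as the monoid operations. $\|\phi\|$ is the number of symbol occurrences in $\phi$. The word problem asks whether two given formulas code the same element. -}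

module Defs where

open import Data.Nat using (ℕ; zero; suc) renaming (_+_ to _+ℕ_; _*_ to _*ℕ_)
open import Data.Integer using (ℤ; +_; _+_; _-_; _<?_; _≤?_; _≟_)
open import Data.Product using (_×_; _,_)
open import Data.Bool using (Bool; true; false; if_then_else_; _∨_; _∧_)
open import Data.List using (List; []; _∷_; _++_; length; [_])
open import Data.Maybe using (Maybe; just; nothing)
open import Data.Fin using (Fin)
open import Relation.Nullary.Decidable using (⌊_⌋)

data Formula : Set where
  𝟎   : Formula
  𝕏   : Formula
  _⋆  : Formula → Formula
  _⊕f_ : Formula → Formula → Formula

data Sym : Set where
  s0 sX sStar sOplus sLpar sRpar : Sym

str : Formula → List Sym
str 𝟎 = [ s0 ]
str 𝕏 = [ sX ]
str (φ ⋆) = str φ ++ [ sStar ]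
str (φ ⊕f ψ) = sLpar ∷ (str φ ++ (sOplus ∷ str ψ ++ [ sRpar ]))

‖_‖ : Formula → ℕ
‖ φ ‖ = length (str φ)

-- E(A_{0,1}) ≅ the unit interval [0,u] of the unital ℓ-group
-- (ℤ ×lex ℤ, u = (1,0)), with x* = u - x and x ⊕ y = (x + y) ∧ u.
-- The generator [p / J₀⁺] is the image of id_[0,1] under
-- M₁ → M₁/J₀⁺ ≅ ℤ ×lex ℤ, f ↦ (f(0), ∂f(0)/∂x⁺), i.e. (0,1).

ℤ² : Set
ℤ² = ℤ × ℤ

_≤lex_ : ℤ² → ℤ² → Bool
(a , b) ≤lex (c , d) = ⌊ a <? c ⌋ ∨ (⌊ a ≟ c ⌋ ∧ ⌊ b ≤? d ⌋)

_⊓_ : ℤ² → ℤ² → ℤ²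
x ⊓ y = if x ≤lex y then x else y

_+²_ : ℤ² → ℤ² → ℤ²
(a , b) +² (c , d) = (a + c , b + d)

u : ℤ²
u = (+ 1 , + 0)

_*E : ℤ² → ℤ²
(a , b) *E = (+ 1 - a , + 0 - b)

_⊕E_ : ℤ² → ℤ² → ℤ²
x ⊕E y = (x +² y) ⊓ u

⟦_⟧ : Formula → ℤ²
⟦ 𝟎 ⟧ = (+ 0 , + 0)
⟦ 𝕏 ⟧ = (+ 0 , + 1)
⟦ φ ⋆ ⟧ = ⟦ φ ⟧ *E
⟦ φ ⊕f ψ ⟧ = ⟦ φ ⟧ ⊕E ⟦ ψ ⟧

-- Polynomials with natural coefficients (constant term first)

Poly : Set
Poly = List ℕ

evalPoly : Poly → ℕ → ℕ
evalPoly [] n = 0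
evalPoly (c ∷ cs) n = c +ℕ n *ℕ evalPoly cs n

-- Deterministic single-tape Turing machines (two-way infinite tape)

data InSym : Set where
  sym : Sym → InSym
  sep : InSym

data Move : Set where
  L R S : Move

data Act (Q Γ : Set) : Set where
  halt : Bool → Act Q Γ                -- halt, accept (true) / reject (false)
  go   : Q → Γ → Move → Act Q Γ

record TM : Set where
  field
    nStates nSyms : ℕ
    blank  : Fin nSyms
    inSym  : InSym → Fin nSyms
    start  : Fin nStates
    δ      : Fin nStates → Fin nSyms → Act (Fin nStates) (Fin nSyms)

record Config (M : TM) : Set where
  constructor cfg
  open TM M
  field
    state : Fin nStates
    left  : List (Fin nSyms)   -- cells left of the head, nearest first
    here  : Fin nSyms
    right : List (Fin nSyms)   -- cells right of the head, nearest first

module _ (M : TM) where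
  open TM M

  moveTo : Fin nStates → Move → List (Fin nSyms) → Fin nSyms → List (Fin nSyms) → Config M
  moveTo q L [] s r = cfg q [] blank (s ∷ r)
  moveTo q L (x ∷ l) s r = cfg q l x (s ∷ r)
  moveTo q R l s [] = cfg q (s ∷ l) blank []
  moveTo q R l s (x ∷ r) = cfg q (s ∷ l) x r
  moveTo q S l s r = cfg q l s r

  -- run with a budget of n steps: `just b` iff the machine halts with
  -- output b after fewer than n transitions
  run : ℕ → Config M → Maybe Bool
  run zero c = nothing
  run (suc n) (cfg q l s r) with δ q s
  ... | halt b = just b
  ... | go q' s' m = run n (moveTo q' m l s' r)

  initial : List InSym → Config M
  initial [] = cfg start [] blank []
  initial (x ∷ xs) = cfg start [] (inSym x) (Data.List.map inSym xs)

input : Formula → Formula → List InSym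
input φ ψ = Data.List.map sym (str φ) ++ (sep ∷ Data.List.map sym (str ψ))

module Submission where

-- Every element of E(𝒜₀,₁) = [(0,0),(1,0)] ⊆ ℤ ×lex ℤ is either
-- (0,n) ("low") or (1,-n) ("high"), so a formula evaluates to a pair
-- (kind , count); * swaps the kind and ⊕ becomes the explicit operation _⊞_.
--
-- The machine rewrites the input in place.  A value is stored as a tag cell
-- (its kind and zero or one unit) followed by a block of Dots (one unit each)
-- and Gaps.  Scanning rightwards, each * flips the tag to its left; each )
-- collects the two operand blocks between the matching ( and ), and either
-- merges them (equal kinds) or cancels Dots pairwise (different kinds).  At the end of the input
-- the two values of φ and ψ are collected the same way and their Dots are
-- cancelled pairwise to test equality of counts.

open import Defs renaming (sym to formulaSym)
open import Data.Nat using (ℕ; zero; suc; _+_; _*_; _∸_; _≤_; z≤n; s≤s)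
open import Data.Nat.Properties
  using (+-assoc; +-comm; +-suc; +-identityʳ; ≤-refl; ≤-trans; ≤-reflexive;
         +-mono-≤; +-monoˡ-≤; +-monoʳ-≤; *-mono-≤; *-monoˡ-≤; m≤m+n; m≤n+m;
         m+[n∸m]≡n; [m+n]∸[m+o]≡n∸o; +-cancelˡ-≡; 0≢1+n; suc-injective; 0∸n≡0; n≤1+n)
open import Data.Nat.Tactic.RingSolver using (solve-∀)
open import Data.Integer as ℤ using (+_; _⊖_)
import Data.Integer.Properties as ℤ
open import Data.Fin using (Fin; zero; suc)
open import Data.Bool using (Bool; true; false; T)
open import Data.Unit using (tt)
open import Data.Empty using (⊥-elim)
open import Data.Product using (Σ; _×_; _,_; proj₂)
open import Data.Maybe using (just)
open import Data.List using (List; []; _∷_; _++_; length; map; reverse; replicate; _ʳ++_; [_])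
open import Data.List.Properties using (++-assoc; length-++; length-ʳ++; ʳ++-defn; map-++; map-∘; length-replicate; ++-identityʳ)
open import Data.List.Relation.Unary.All as All using (All; []; _∷_)
open import Data.List.Relation.Unary.All.Properties using (++⁺; replicate⁺)
open import Function.Bundles using (_⇔_; mk⇔)
import Function.Properties.Equivalence as ⇔
open import Relation.Binary.PropositionalEquality hiding ([_])

≤-by : ∀ {m n} k → m + k ≡ n → m ≤ n
≤-by {m} k refl = m≤m+n m k

-- The elements of E(𝒜₀,₁)

data Kind : Set where
  low high : Kind

swap : Kind → Kind
swap low  = high
swap high = low

value : Kind × ℕ → ℤ²
value (low  , n) = (+ 0 , + n)
value (high , n) = (+ 1 , ℤ.- (+ n))

value-injective : ∀ {x y} → value x ≡ value y → x ≡ y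
value-injective {low  , _} {low  , _} refl = refl
value-injective {low  , _} {high , _} ()
value-injective {high , _} {low  , _} ()
value-injective {high , a} {high , b} e =
  cong (high ,_) (ℤ.+-injective (ℤ.neg-injective (cong proj₂ e)))

starV : Kind × ℕ → Kind × ℕ
starV (κ , n) = (swap κ , n)

value-⋆ : ∀ x → value x *E ≡ value (starV x)
value-⋆ (low  , zero)  = refl
value-⋆ (low  , suc n) = refl
value-⋆ (high , zero)  = refl
value-⋆ (high , suc n) = refl

_⊞_ : Kind × ℕ → Kind × ℕ → Kind × ℕ
(low  , a) ⊞ (low  , b) = low  , a + b
(low  , a) ⊞ (high , b) = high , b ∸ a
(high , a) ⊞ (low  , b) = high , a ∸ b
(high , _) ⊞ (high , _) = high , 0

clip : ∀ a b → (+ 1 , a ⊖ b) ⊓ u ≡ value (high , b ∸ a)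
clip zero    zero    = refl
clip zero    (suc b) = refl
clip (suc a) zero    = refl
clip (suc a) (suc b) = trans (cong (λ z → (+ 1 , z) ⊓ u) (ℤ.[1+m]⊖[1+n]≡m⊖n a b)) (clip a b)

value-⊕ : ∀ x y → value x ⊕E value y ≡ value (x ⊞ y)
value-⊕ (low  , a) (low  , b) = refl
value-⊕ (low  , a) (high , b) = trans (cong (λ z → (+ 1 , z) ⊓ u) (ℤ.m-n≡m⊖n a b)) (clip a b)
value-⊕ (high , a) (low  , b) =
  trans (cong (λ z → (+ 1 , z) ⊓ u) (trans (ℤ.+-comm (ℤ.- (+ a)) (+ b)) (ℤ.m-n≡m⊖n b a))) (clip b a)
value-⊕ (high , a) (high , b) = refl

eval : Formula → Kind × ℕ
eval 𝟎 = (low , 0)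
eval 𝕏 = (low , 1)
eval (φ ⋆) = starV (eval φ)
eval (φ ⊕f ψ) = eval φ ⊞ eval ψ

eval-correct : ∀ φ → value (eval φ) ≡ ⟦ φ ⟧
eval-correct 𝟎 = refl
eval-correct 𝕏 = refl
eval-correct (φ ⋆) = trans (sym (value-⋆ (eval φ))) (cong _*E (eval-correct φ))
eval-correct (φ ⊕f ψ) =
  trans (sym (value-⊕ (eval φ) (eval ψ))) (cong₂ _⊕E_ (eval-correct φ) (eval-correct ψ))

-- Bounded runs of a Turing machine

module Execution (M : TM) where
  open TM M

  Configuration : Set
  Configuration = Config M

  Tape : Set
  Tape = List (Fin nSyms)

  -- The head scans the first cell of r (a blank if r is empty); l holds the
  -- cells to its left, nearest first.
  at : Fin nStates → Tape → Tape → Configuration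
  at q l []      = cfg q l blank []
  at q l (x ∷ r) = cfg q l x r

  atLeft : Fin nStates → Tape → Tape → Configuration
  atLeft q []      r = cfg q [] blank r
  atLeft q (x ∷ l) r = cfg q l x r

  infix  2 _⟶⟨_⟩_ _⇓⟨_⟩_
  infixr 5 _▸_ _≡▸_
  infixr 4 _▸ₕ_
  infixl 3 _▸≡_ _within_ _withinₕ_

  record _⟶⟨_⟩_ (c : Configuration) (k : ℕ) (c' : Configuration) : Set where
    constructor reach
    field
      steps  : ℕ
      bound  : steps ≤ k
      agrees : ∀ n → run M (steps + n) c ≡ run M n c'

  record _⇓⟨_⟩_ (c : Configuration) (k : ℕ) (b : Bool) : Set where
    constructor halts
    field
      steps  : ℕ
      bound  : steps ≤ k
      result : ∀ n → run M (steps + n) c ≡ just b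

  idle : ∀ {c} → c ⟶⟨ 0 ⟩ c
  idle = reach 0 z≤n (λ n → refl)

  _▸_ : ∀ {c c' c'' k k'} → c ⟶⟨ k ⟩ c' → c' ⟶⟨ k' ⟩ c'' → c ⟶⟨ k + k' ⟩ c''
  _▸_ {c} (reach s p e) (reach s' p' e') =
    reach (s + s') (+-mono-≤ p p') λ n → trans (cong (λ m → run M m c) (+-assoc s s' n)) (trans (e (s' + n)) (e' n))

  _▸ₕ_ : ∀ {c c' k k' b} → c ⟶⟨ k ⟩ c' → c' ⇓⟨ k' ⟩ b → c ⇓⟨ k + k' ⟩ b
  _▸ₕ_ {c} (reach s p e) (halts s' p' e') =
    halts (s + s') (+-mono-≤ p p') λ n → trans (cong (λ m → run M m c) (+-assoc s s' n)) (trans (e (s' + n)) (e' n))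

  _within_ : ∀ {c c' k k'} → c ⟶⟨ k ⟩ c' → k ≤ k' → c ⟶⟨ k' ⟩ c'
  reach s p e within q = reach s (≤-trans p q) e

  _withinₕ_ : ∀ {c k k' b} → c ⇓⟨ k ⟩ b → k ≤ k' → c ⇓⟨ k' ⟩ b
  halts s p e withinₕ q = halts s (≤-trans p q) e

  _≡▸_ : ∀ {c c' c'' k} → c ≡ c' → c' ⟶⟨ k ⟩ c'' → c ⟶⟨ k ⟩ c''
  refl ≡▸ p = p

  _▸≡_ : ∀ {c c' c'' k} → c ⟶⟨ k ⟩ c' → c' ≡ c'' → c ⟶⟨ k ⟩ c''
  p ▸≡ refl = p

  run-budget : ∀ {c k b n} → c ⇓⟨ k ⟩ b → k ≤ n → run M n c ≡ just b
  run-budget {c} {b = b} {n} (halts s p e) k≤n =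
    subst (λ m → run M m c ≡ just b) (m+[n∸m]≡n (≤-trans p k≤n)) (e (n ∸ s))

  stepR : ∀ {q x q' y} l r → δ q x ≡ go q' y R → at q l (x ∷ r) ⟶⟨ 1 ⟩ at q' (y ∷ l) r
  stepR l r eq = reach 1 ≤-refl (runs l r eq)
    where
    runs : ∀ {q x q' y} l r → δ q x ≡ go q' y R →
           ∀ n → run M (suc n) (at q l (x ∷ r)) ≡ run M n (at q' (y ∷ l) r)
    runs l []      eq n rewrite eq = refl
    runs l (_ ∷ r) eq n rewrite eq = refl

  stepL : ∀ {q x q' y} l r → δ q x ≡ go q' y L → at q l (x ∷ r) ⟶⟨ 1 ⟩ atLeft q' l (y ∷ r)
  stepL l r eq = reach 1 ≤-refl (runs l r eq)
    where
    runs : ∀ {q x q' y} l r → δ q x ≡ go q' y L →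
           ∀ n → run M (suc n) (at q l (x ∷ r)) ≡ run M n (atLeft q' l (y ∷ r))
    runs []      r eq n rewrite eq = refl
    runs (_ ∷ l) r eq n rewrite eq = refl

  stepH : ∀ {q x b} l r → δ q x ≡ halt b → at q l (x ∷ r) ⇓⟨ 1 ⟩ b
  stepH l r eq = halts 1 ≤-refl (runs eq)
    where
    runs : ∀ {q x b} → δ q x ≡ halt b → ∀ n → run M (suc n) (at q l (x ∷ r)) ≡ just b
    runs eq n rewrite eq = refl

  sweepR : ∀ {q W} → All (λ x → δ q x ≡ go q x R) W → ∀ l r →
           at q l (W ++ r) ⟶⟨ length W ⟩ at q (W ʳ++ l) r
  sweepR []       l r = idle
  sweepR (e ∷ es) l r = stepR l _ e ▸ sweepR es _ r

  sweepR' : ∀ {q W} → All (λ x → δ q x ≡ go q x R) W → ∀ l r →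
            at q l (W ʳ++ r) ⟶⟨ length W ⟩ at q (W ++ l) r
  sweepR' []                 l r = idle
  sweepR' {W = x ∷ W} (e ∷ es) l r =
    sweepR' es l (x ∷ r) ▸ stepR (W ++ l) r e within ≤-reflexive (+-comm (length W) 1)

  sweepL : ∀ {q W} → All (λ x → δ q x ≡ go q x L) W → ∀ l r →
           atLeft q (W ++ l) r ⟶⟨ length W ⟩ atLeft q l (W ʳ++ r)
  sweepL []                 l r = idle
  sweepL {W = x ∷ W} (e ∷ es) l r = stepL (W ++ l) r e ▸ sweepL es l (x ∷ r)

  sweepL' : ∀ {q W} → All (λ x → δ q x ≡ go q x L) W → ∀ l r →
            atLeft q (W ʳ++ l) r ⟶⟨ length W ⟩ atLeft q l (W ++ r)
  sweepL' []                 l r = idle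
  sweepL' {W = x ∷ W} (e ∷ es) l r =
    sweepL' es (x ∷ l) r ▸ stepL l (W ++ r) e within ≤-reflexive (+-comm (length W) 1)

  sweepR-writing : ∀ {q W} y → All (λ x → δ q x ≡ go q y R) W → ∀ l r →
                   at q l (W ++ r) ⟶⟨ length W ⟩ at q (replicate (length W) y ʳ++ l) r
  sweepR-writing y []       l r = idle
  sweepR-writing y (e ∷ es) l r = stepR l _ e ▸ sweepR-writing y es _ r

-- The machine

Symbol : Set
Symbol = Fin 15

State : Set
State = Fin 20

-- Lo₀ Lo₁ Hi₀ Hi₁ are tags (kind, one unit or none); Dot and
-- Gap fill value blocks; End marks a consumed ")"; MarkLH and MarkHL mark a
-- consumed "(" whose operands (of kinds low/high resp. high/low) are being
-- cancelled against each other.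
pattern Blank  = zero
pattern Lo₀    = suc Blank
pattern Lo₁    = suc Lo₀
pattern Hi₀    = suc Lo₁
pattern Hi₁    = suc Hi₀
pattern Dot    = suc Hi₁
pattern Gap    = suc Dot
pattern Star   = suc Gap
pattern Plus   = suc Star
pattern LPar   = suc Plus
pattern RPar   = suc LPar
pattern Sep    = suc RPar
pattern End    = suc Sep
pattern MarkLH = suc End
pattern MarkHL = suc MarkLH

pattern Scan         = zero
pattern Flip         = suc Scan
pattern CollectRight = suc Flip
pattern CrossLo      = suc CollectRight
pattern CrossHi      = suc CrossLo
pattern CollectLo    = suc CrossHi
pattern CollectHi    = suc CollectLo
pattern DecideLL     = suc CollectHi
pattern DecideLH     = suc DecideLL
pattern DecideHL     = suc DecideLH
pattern DecideHH     = suc DecideHL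
pattern Seek         = suc DecideHH
pattern ToSep        = suc Seek
pattern SeekR        = suc ToSep
pattern Rewind       = suc SeekR
pattern LeftDone     = suc Rewind
pattern RightDone    = suc LeftDone
pattern Keep         = suc RightDone
pattern Wipe         = suc Keep
pattern Check        = suc Wipe

cross : Kind → State
cross low  = CrossLo
cross high = CrossHi

collectLeft : Kind → State
collectLeft low  = CollectLo
collectLeft high = CollectHi

decide : Kind → Kind → State
decide low  low  = DecideLL
decide low  high = DecideLH
decide high low  = DecideHL
decide high high = DecideHH

δ : State → Symbol → Act State Symbol
-- Scan right; a * flips the value to its left, a ) or the end of the input
-- starts the collection of the two values to its left.
δ Scan Star  = go Flip Gap L
δ Scan RPar  = go CollectRight End L
δ Scan Blank = go CollectRight Blank L
δ Scan x     = go Scan x R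
-- Move left to the tag and flip its kind.
δ Flip Lo₀ = go Scan Hi₀ R
δ Flip Lo₁ = go Scan Hi₁ R
δ Flip Hi₀ = go Scan Lo₀ R
δ Flip Hi₁ = go Scan Lo₁ R
δ Flip x   = go Flip x L
-- Collect the right value: turn its tag into a cell and remember its kind.
δ CollectRight Lo₀ = go CrossLo Gap L
δ CollectRight Lo₁ = go CrossLo Dot L
δ CollectRight Hi₀ = go CrossHi Gap L
δ CollectRight Hi₁ = go CrossHi Dot L
δ CollectRight x   = go CollectRight x L
δ CrossLo Plus = go CollectLo Plus L
δ CrossLo Sep  = go CollectLo Sep L
δ CrossHi Plus = go CollectHi Plus L
δ CrossHi Sep  = go CollectHi Sep L
-- Collect the left value likewise.
δ CollectLo Lo₀ = go DecideLL Gap L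
δ CollectLo Lo₁ = go DecideLL Dot L
δ CollectLo Hi₀ = go DecideHL Gap L
δ CollectLo Hi₁ = go DecideHL Dot L
δ CollectLo x   = go CollectLo x L
δ CollectHi Lo₀ = go DecideLH Gap L
δ CollectHi Lo₁ = go DecideLH Dot L
δ CollectHi Hi₀ = go DecideHH Gap L
δ CollectHi Hi₁ = go DecideHH Dot L
δ CollectHi x   = go CollectHi x L
-- At "(": merge equal kinds, cancel different kinds.  At the left end of the
-- tape: compare the counts if the kinds agree, reject otherwise.
δ DecideLL LPar  = go Keep Lo₀ R
δ DecideHH LPar  = go Wipe Hi₀ R
δ DecideLH LPar  = go Seek MarkLH R
δ DecideHL LPar  = go Seek MarkHL R
δ DecideLL Blank = go Seek Blank R
δ DecideHH Blank = go Seek Blank R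
-- One cancellation round: erase the first Dot left of the separator and the
-- first Dot right of it, then rewind to the anchor.
δ Seek Gap  = go Seek Gap R
δ Seek Dot  = go ToSep Gap R
δ Seek Plus = go LeftDone Plus L
δ Seek Sep  = go Check Sep R
δ ToSep Plus = go SeekR Plus R
δ ToSep Sep  = go SeekR Sep R
δ ToSep x    = go ToSep x R
δ SeekR Gap = go SeekR Gap R
δ SeekR Dot = go Rewind Gap L
δ SeekR End = go RightDone End L
δ Rewind MarkLH = go Seek MarkLH R
δ Rewind MarkHL = go Seek MarkHL R
δ Rewind Blank  = go Seek Blank R
δ Rewind x      = go Rewind x L
-- The left operand ran out of Dots (first) or the right one did.
δ LeftDone MarkLH  = go Keep Hi₀ R
δ LeftDone MarkHL  = go Wipe Hi₀ R
δ LeftDone x       = go LeftDone x L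
δ RightDone MarkLH = go Wipe Hi₀ R
δ RightDone MarkHL = go Keep Hi₁ R
δ RightDone x      = go RightDone x L
-- Close up the two regions into one block, keeping or erasing their Dots.
δ Keep Plus = go Keep Gap R
δ Keep End  = go Scan Gap R
δ Keep x    = go Keep x R
δ Wipe End  = go Scan Gap R
δ Wipe x    = go Wipe Gap R
-- The left count is exhausted: accept iff the right one is too.
δ Check Gap   = go Check Gap R
δ Check Blank = halt true
δ _ _ = halt false

cell : Sym → Symbol
cell s0     = Lo₀
cell sX     = Lo₁
cell sStar  = Star
cell sOplus = Plus
cell sLpar  = LPar
cell sRpar  = RPar

inSymbol : InSym → Symbol
inSymbol (formulaSym s) = cell s
inSymbol sep            = Sep

machine : TM
machine = record
  { nStates = 20 ; nSyms = 15 ; blank = Blank ; inSym = inSymbol ; start = Scan ; δ = δ }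

open Execution machine

-- Stored values

data Tag : Symbol → Kind → ℕ → Set where
  lo₀ : Tag Lo₀ low  0
  lo₁ : Tag Lo₁ low  1
  hi₀ : Tag Hi₀ high 0
  hi₁ : Tag Hi₁ high 1

data Block : Symbol → Set where
  gap : Block Gap
  dot : Block Dot

flipTag : Symbol → Symbol
flipTag Lo₀ = Hi₀
flipTag Lo₁ = Hi₁
flipTag Hi₀ = Lo₀
flipTag Hi₁ = Lo₁
flipTag x   = x

tag-flip : ∀ {t κ b} → Tag t κ b → Tag (flipTag t) (swap κ) b
tag-flip lo₀ = hi₀
tag-flip lo₁ = hi₁
tag-flip hi₀ = lo₀
tag-flip hi₁ = lo₁

untag : Symbol → Symbol
untag Lo₁ = Dot
untag Hi₁ = Dot
untag _   = Gap

untag-block : ∀ {t κ b} → Tag t κ b → Block (untag t)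
untag-block lo₀ = gap
untag-block lo₁ = dot
untag-block hi₀ = gap
untag-block hi₁ = dot

weight : Symbol → ℕ
weight Dot = 1
weight _   = 0

untag-weight : ∀ {t κ b} → Tag t κ b → weight (untag t) ≡ b
untag-weight lo₀ = refl
untag-weight lo₁ = refl
untag-weight hi₀ = refl
untag-weight hi₁ = refl

dots : List Symbol → ℕ
dots []       = 0
dots (x ∷ xs) = weight x + dots xs

dots-++ : ∀ xs ys → dots (xs ++ ys) ≡ dots xs + dots ys
dots-++ []       ys = refl
dots-++ (x ∷ xs) ys = trans (cong (λ n → weight x + n) (dots-++ xs ys)) (sym (+-assoc (weight x) (dots xs) (dots ys)))

dots-ʳ++ : ∀ xs ys → dots (xs ʳ++ ys) ≡ dots xs + dots ys
dots-ʳ++ []       ys = refl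
dots-ʳ++ (x ∷ xs) ys = trans (dots-ʳ++ xs (x ∷ ys)) (shuffle (dots xs) (weight x) (dots ys))
  where
  shuffle : ∀ a b c → a + (b + c) ≡ (b + a) + c
  shuffle = solve-∀

dots-reverse : ∀ xs → dots (reverse xs) ≡ dots xs
dots-reverse xs = trans (dots-ʳ++ xs []) (+-identityʳ (dots xs))

dots-gaps : ∀ {xs} → All (_≡ Gap) xs → dots xs ≡ 0
dots-gaps []          = refl
dots-gaps (refl ∷ gs) = dots-gaps gs

dots≤length : ∀ {xs} → All Block xs → dots xs ≤ length xs
dots≤length []         = z≤n
dots≤length (gap ∷ bs) = ≤-trans (dots≤length bs) (m≤n+m _ 1)
dots≤length (dot ∷ bs) = s≤s (dots≤length bs)

dots-erase : ∀ (A C : List Symbol) → dots (A ++ Dot ∷ C) ≡ suc (dots (A ++ Gap ∷ C))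
dots-erase A C = begin
  dots (A ++ Dot ∷ C)        ≡⟨ dots-++ A (Dot ∷ C) ⟩
  dots A + suc (dots C)      ≡⟨ +-suc (dots A) (dots C) ⟩
  suc (dots A + dots C)      ≡⟨ cong suc (sym (dots-++ A (Gap ∷ C))) ⟩
  suc (dots (A ++ Gap ∷ C))  ∎
  where open ≡-Reasoning

length-erase : ∀ (A C : List Symbol) → length (A ++ Gap ∷ C) ≡ length (A ++ Dot ∷ C)
length-erase A C = trans (length-++ A) (sym (length-++ A))

All-ʳ++ : ∀ {P : Symbol → Set} {xs ys} → All P xs → All P ys → All P (xs ʳ++ ys)
All-ʳ++ []       qs = qs
All-ʳ++ (p ∷ ps) qs = All-ʳ++ ps (p ∷ qs)

gaps⇒blocks : ∀ {xs} → All (_≡ Gap) xs → All Block xs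
gaps⇒blocks = All.map λ { refl → gap }

erased : ∀ {A C} → All (_≡ Gap) A → All Block C → All Block (A ++ Gap ∷ C)
erased gA bC = ++⁺ (gaps⇒blocks gA) (gap ∷ bC)

ʳ++-++ : ∀ (xs ys zs : List Symbol) → xs ʳ++ (ys ++ zs) ≡ (xs ʳ++ ys) ++ zs
ʳ++-++ xs ys zs = begin
  xs ʳ++ (ys ++ zs)       ≡⟨ ʳ++-defn xs ⟩
  reverse xs ++ ys ++ zs  ≡⟨ sym (++-assoc (reverse xs) ys zs) ⟩
  (reverse xs ++ ys) ++ zs ≡⟨ cong (_++ zs) (sym (ʳ++-defn xs)) ⟩
  (xs ʳ++ ys) ++ zs       ∎
  where open ≡-Reasoning

-- The value v is stored as the tag t followed (rightwards) by the block B.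
data Stores (v : Kind × ℕ) (t : Symbol) (B : List Symbol) : Set where
  stores : ∀ {κ b} → Tag t κ b → All Block B → (κ , b + dots B) ≡ v → Stores v t B

record Produces (c : Configuration) (k : ℕ) (v : Kind × ℕ) (n : ℕ) (l r : List Symbol) : Set where
  constructor produces
  field
    tag     : Symbol
    block   : List Symbol
    stored  : Stores v tag block
    size    : length block ≡ n
    reaches : c ⟶⟨ k ⟩ at Scan (block ++ tag ∷ l) r

infixr 4 _▸ₚ_ _▸ᵈ_

_▸ₚ_ : ∀ {c c' k k' v n l r} → c ⟶⟨ k ⟩ c' → Produces c' k' v n l r → Produces c (k + k') v n l r
p ▸ₚ produces t B st sz q = produces t B st sz (p ▸ q)

produces-≤ : ∀ {c k k' v n l r} → Produces c k v n l r → k ≤ k' → Produces c k' v n l r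
produces-≤ (produces t B st sz q) le = produces t B st sz (q within le)

produces-value : ∀ {c k v v' n l r} → v ≡ v' → Produces c k v n l r → Produces c k v' n l r
produces-value refl p = p

produces-size : ∀ {c k v n n' l r} → n ≡ n' → Produces c k v n l r → Produces c k v n' l r
produces-size refl p = p

record Decides (c : Configuration) (k : ℕ) (P : Set) : Set where
  constructor decides
  field
    answer  : Bool
    halting : c ⇓⟨ k ⟩ answer
    correct : T answer ⇔ P

_▸ᵈ_ : ∀ {c c' k k' P} → c ⟶⟨ k ⟩ c' → Decides c' k' P → Decides c (k + k') P
p ▸ᵈ decides b h ok = decides b (p ▸ₕ h) ok

decides-≤ : ∀ {c k k' P} → Decides c k P → k ≤ k' → Decides c k' P
decides-≤ (decides b h ok) le = decides b (h withinₕ le) ok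

decides-⇔ : ∀ {c k P Q} → P ⇔ Q → Decides c k P → Decides c k Q
decides-⇔ P⇔Q (decides b h ok) = decides b h (⇔.trans ok P⇔Q)

over-gaps : ∀ q {d W} → δ q Gap ≡ go q Gap d → All (_≡ Gap) W → All (λ x → δ q x ≡ go q x d) W
over-gaps q e = All.map λ { refl → e }

over-blocks : ∀ q {d W} → δ q Gap ≡ go q Gap d → δ q Dot ≡ go q Dot d → All Block W → All (λ x → δ q x ≡ go q x d) W
over-blocks q g e = All.map λ { gap → g ; dot → e }

-- The star phase

phaseCost : ℕ → ℕ
phaseCost s = 2 * s * s

flip-tag : ∀ {t κ b} → Tag t κ b → δ Flip t ≡ go Scan (flipTag t) R
flip-tag lo₀ = refl
flip-tag lo₁ = refl
flip-tag hi₀ = refl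
flip-tag hi₁ = refl

-- At a *, the head walks left to the tag, flips it, and returns; the * is
-- absorbed into the block as a Gap.
star-phase : ∀ {v t B} → Stores v t B → ∀ l r →
  Produces (at Scan (B ++ t ∷ l) (Star ∷ r)) (phaseCost (length B + 2)) (starV v) (suc (length B)) l r
star-phase {t = t} {B} (stores tg bs refl) l r =
  produces (flipTag t) (Gap ∷ B) (stores (tag-flip tg) (gap ∷ bs) refl) refl
    (stepL (B ++ t ∷ l) r refl
     ▸ sweepL (over-blocks Flip refl refl bs) (t ∷ l) (Gap ∷ r)
     ▸ stepR l _ (flip-tag tg)
     ▸ sweepR' (over-blocks Scan refl refl bs) (flipTag t ∷ l) (Gap ∷ r)
     ▸ stepR _ r refl
     within ≤-by (2 * length B * length B + 6 * length B + 5) (cost (length B)))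
  where
  cost : ∀ n → 1 + (n + (1 + (n + 1))) + (2 * n * n + 6 * n + 5) ≡ 2 * (n + 2) * (n + 2)
  cost = solve-∀

-- Collecting two values

-- The separators between the two collected values: ⊕ inside a formula, and
-- the input separator between φ and ψ.
data Separator : Symbol → Set where
  plus : Separator Plus
  sep  : Separator Sep

collect-right : ∀ {t κ b} → Tag t κ b → δ CollectRight t ≡ go (cross κ) (untag t) L
collect-right lo₀ = refl
collect-right lo₁ = refl
collect-right hi₀ = refl
collect-right hi₁ = refl

cross-separator : ∀ {s} → Separator s → ∀ κ → δ (cross κ) s ≡ go (collectLeft κ) s L
cross-separator plus low  = refl
cross-separator plus high = refl
cross-separator sep  low  = refl
cross-separator sep  high = refl

collect-left : ∀ κ₂ {t κ₁ b} → Tag t κ₁ b → δ (collectLeft κ₂) t ≡ go (decide κ₁ κ₂) (untag t) L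
collect-left low  lo₀ = refl
collect-left low  lo₁ = refl
collect-left low  hi₀ = refl
collect-left low  hi₁ = refl
collect-left high lo₀ = refl
collect-left high lo₁ = refl
collect-left high hi₀ = refl
collect-left high hi₁ = refl

region : Symbol → List Symbol → List Symbol
region t B = untag t ∷ reverse B

region-blocks : ∀ {t κ b B} → Tag t κ b → All Block B → All Block (region t B)
region-blocks tg bs = untag-block tg ∷ All-ʳ++ bs []

region-dots : ∀ {t κ b} B → Tag t κ b → dots (region t B) ≡ b + dots B
region-dots B tg = cong₂ _+_ (untag-weight tg) (dots-reverse B)

length-region : ∀ t (B : List Symbol) → length (region t B) ≡ suc (length B)
length-region t B = cong suc (trans (length-ʳ++ B) (+-identityʳ (length B)))

collect-phase : ∀ {x y s κ₁ n₁ t₁ B₁ κ₂ n₂ t₂ B₂} →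
  δ Scan x ≡ go CollectRight y L → Separator s →
  Stores (κ₁ , n₁) t₁ B₁ → Stores (κ₂ , n₂) t₂ B₂ → ∀ l r →
  at Scan (B₂ ++ t₂ ∷ s ∷ B₁ ++ t₁ ∷ l) (x ∷ r) ⟶⟨ length B₁ + length B₂ + 4 ⟩
  atLeft (decide κ₁ κ₂) l (region t₁ B₁ ++ s ∷ region t₂ B₂ ++ y ∷ r)
collect-phase {y = y} {s} {t₁ = t₁} {B₁} {κ₂ = κ₂} {t₂ = t₂} {B₂} trigger sp
              (stores tg₁ bs₁ refl) (stores tg₂ bs₂ refl) l r =
  stepL (B₂ ++ t₂ ∷ s ∷ B₁ ++ t₁ ∷ l) r trigger
  ▸ sweepL (over-blocks CollectRight refl refl bs₂) (t₂ ∷ s ∷ B₁ ++ t₁ ∷ l) (y ∷ r)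
  ▸ stepL (s ∷ B₁ ++ t₁ ∷ l) _ (collect-right tg₂)
  ▸ stepL (B₁ ++ t₁ ∷ l) _ (cross-separator sp κ₂)
  ▸ sweepL (over-blocks (collectLeft κ₂) (gap-left κ₂) (dot-left κ₂) bs₁) (t₁ ∷ l) _
  ▸ stepL l _ (collect-left κ₂ tg₁)
  ▸≡ cong (atLeft _ l) (cong (untag t₁ ∷_) regions)
  within ≤-reflexive (cost (length B₁) (length B₂))
  where
  gap-left : ∀ κ → δ (collectLeft κ) Gap ≡ go (collectLeft κ) Gap L
  gap-left low  = refl
  gap-left high = refl
  dot-left : ∀ κ → δ (collectLeft κ) Dot ≡ go (collectLeft κ) Dot L
  dot-left low  = refl
  dot-left high = refl
  regions : B₁ ʳ++ (s ∷ untag t₂ ∷ B₂ ʳ++ (y ∷ r)) ≡ reverse B₁ ++ s ∷ region t₂ B₂ ++ y ∷ r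
  regions = trans (ʳ++-defn B₁) (cong (λ z → reverse B₁ ++ s ∷ untag t₂ ∷ z) (ʳ++-defn B₂))
  cost : ∀ a b → 1 + (b + (1 + (1 + (a + 1)))) ≡ a + b + 4
  cost = solve-∀

-- Closing up two regions into one block

-- Two regions W₁ ⊕ W₂ closed up into one block (⊕ and the end marker become
-- Gaps).
merge : List Symbol → List Symbol → List Symbol
merge W₁ W₂ = Gap ∷ W₂ ʳ++ (Gap ∷ reverse W₁)

merge-shape : ∀ W₁ W₂ (T : Symbol) l → Gap ∷ W₂ ʳ++ (Gap ∷ W₁ ʳ++ (T ∷ l)) ≡ merge W₁ W₂ ++ T ∷ l
merge-shape W₁ W₂ T l =
  cong (Gap ∷_) (trans (cong (λ z → W₂ ʳ++ (Gap ∷ z)) (ʳ++-defn W₁)) (ʳ++-++ W₂ (Gap ∷ reverse W₁) (T ∷ l)))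

merge-blocks : ∀ {W₁ W₂} → All Block W₁ → All Block W₂ → All Block (merge W₁ W₂)
merge-blocks bs₁ bs₂ = gap ∷ All-ʳ++ bs₂ (gap ∷ All-ʳ++ bs₁ [])

merge-dots : ∀ W₁ W₂ → dots (merge W₁ W₂) ≡ dots W₁ + dots W₂
merge-dots W₁ W₂ = trans (dots-ʳ++ W₂ _) (trans (cong (λ z → dots W₂ + z) (dots-reverse W₁)) (+-comm (dots W₂) (dots W₁)))

length-merge : ∀ W₁ W₂ → length (merge W₁ W₂) ≡ length W₁ + length W₂ + 2
length-merge W₁ W₂ =
  trans (cong suc (trans (length-ʳ++ W₂) (cong (λ z → length W₂ + suc z) (trans (length-ʳ++ W₁) (+-identityʳ _)))))
        (shape (length W₁) (length W₂))
  where
  shape : ∀ a b → suc (b + suc a) ≡ a + b + 2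
  shape = solve-∀

keep-phase : ∀ {T κ b V₁ V₂} → Tag T κ b → All Block V₁ → All Block V₂ → ∀ l r →
  Produces (at Keep (T ∷ l) (V₁ ++ Plus ∷ V₂ ++ End ∷ r)) (length V₁ + length V₂ + 2)
           (κ , b + (dots V₁ + dots V₂)) (length V₁ + length V₂ + 2) l r
keep-phase {T} {V₁ = V₁} {V₂} tg bs₁ bs₂ l r =
  produces T (merge V₁ V₂)
    (stores tg (merge-blocks bs₁ bs₂) (cong (λ z → _ , _ + z) (merge-dots V₁ V₂)))
    (length-merge V₁ V₂)
    (sweepR (over-blocks Keep refl refl bs₁) (T ∷ l) _
     ▸ stepR _ _ refl
     ▸ sweepR (over-blocks Keep refl refl bs₂) _ _
     ▸ stepR _ r refl
     ▸≡ cong (λ z → at Scan z r) (merge-shape V₁ V₂ T l)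
     within ≤-reflexive (cost (length V₁) (length V₂)))
  where
  cost : ∀ a b → a + (1 + (b + 1)) ≡ a + b + 2
  cost = solve-∀

wipe-phase : ∀ {T κ b V₁ V₂} → Tag T κ b → All Block V₁ → All Block V₂ → ∀ l r →
  Produces (at Wipe (T ∷ l) (V₁ ++ Plus ∷ V₂ ++ End ∷ r)) (length V₁ + length V₂ + 2)
           (κ , b) (length V₁ + length V₂ + 2) l r
wipe-phase {T} {κ} {b} {V₁} {V₂} tg bs₁ bs₂ l r =
  produces T (merge G₁ G₂)
    (stores tg (merge-blocks (gaps⇒blocks gs₁) (gaps⇒blocks gs₂)) no-dots)
    (trans (length-merge G₁ G₂) (cong₂ (λ a b → a + b + 2) (length-replicate (length V₁)) (length-replicate (length V₂))))
    (sweepR-writing Gap (wipes bs₁) (T ∷ l) _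
     ▸ stepR _ _ refl
     ▸ sweepR-writing Gap (wipes bs₂) _ _
     ▸ stepR _ r refl
     ▸≡ cong (λ z → at Scan z r) (merge-shape G₁ G₂ T l)
     within ≤-reflexive (cost (length V₁) (length V₂)))
  where
  G₁ G₂ : List Symbol
  G₁ = replicate (length V₁) Gap
  G₂ = replicate (length V₂) Gap
  gs₁ : All (_≡ Gap) G₁
  gs₁ = replicate⁺ (length V₁) refl
  gs₂ : All (_≡ Gap) G₂
  gs₂ = replicate⁺ (length V₂) refl
  no-dots : (κ , b + dots (merge G₁ G₂)) ≡ (κ , b)
  no-dots = cong (κ ,_) (trans (cong (λ z → b + z) (trans (merge-dots G₁ G₂) (cong₂ _+_ (dots-gaps gs₁) (dots-gaps gs₂))))
                               (+-identityʳ b))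
  wipes : ∀ {W} → All Block W → All (λ x → δ Wipe x ≡ go Wipe Gap R) W
  wipes = All.map λ { gap → refl ; dot → refl }
  cost : ∀ a b → a + (1 + (b + 1)) ≡ a + b + 2
  cost = solve-∀

-- Cancelling Dots pairwise

-- The cell from which a cancellation round starts: a mark at a consumed "(",
-- or the left end of the tape.
data Anchor : Symbol → Set where
  markLH : Anchor MarkLH
  markHL : Anchor MarkHL
  blank  : Anchor Blank

rewind-anchor : ∀ {a} → Anchor a → δ Rewind a ≡ go Seek a R
rewind-anchor markLH = refl
rewind-anchor markHL = refl
rewind-anchor blank  = refl

to-separator : ∀ {s} → Separator s → δ ToSep s ≡ go SeekR s R
to-separator plus = refl
to-separator sep  = refl

rewind-separator : ∀ {s} → Separator s → δ Rewind s ≡ go Rewind s L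
rewind-separator plus = refl
rewind-separator sep  = refl

roundCost : ℕ → ℕ
roundCost n = 2 * n + 2

round : ∀ {a s A C A' C'} → Anchor a → Separator s →
  All (_≡ Gap) A → All Block C → All (_≡ Gap) A' → All Block C' → ∀ l r →
  at Seek (a ∷ l) ((A ++ Dot ∷ C) ++ s ∷ (A' ++ Dot ∷ C') ++ r)
    ⟶⟨ roundCost (length (A ++ Dot ∷ C) + length (A' ++ Dot ∷ C')) ⟩
  at Seek (a ∷ l) ((A ++ Gap ∷ C) ++ s ∷ (A' ++ Gap ∷ C') ++ r)
round {a} {s} {A} {C} {A'} {C'} an sp gA bC gA' bC' l r =
  cong (at Seek (a ∷ l)) (flatten Dot)
  ≡▸ sweepR (over-gaps Seek refl gA) (a ∷ l) _
  ▸ stepR _ _ refl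
  ▸ sweepR (over-blocks ToSep refl refl bC) _ _
  ▸ stepR _ _ (to-separator sp)
  ▸ sweepR (over-gaps SeekR refl gA') _ _
  ▸ stepL _ _ refl
  ▸ sweepL' (over-gaps Rewind refl gA') _ _
  ▸ stepL _ _ (rewind-separator sp)
  ▸ sweepL' (over-blocks Rewind refl refl bC) _ _
  ▸ stepL _ _ refl
  ▸ sweepL' (over-gaps Rewind refl gA) (a ∷ l) _
  ▸ stepR l _ (rewind-anchor an)
  ▸≡ cong (at Seek (a ∷ l)) (sym (flatten Gap))
  within ≤-trans (≤-by (2 * length C') (cost (length A) (length C) (length A') (length C')))
                 (≤-reflexive (cong₂ (λ m n → 2 * (m + n) + 2) (sym (length-++ A)) (sym (length-++ A'))))
  where
  flatten : ∀ x → (A ++ x ∷ C) ++ s ∷ (A' ++ x ∷ C') ++ r ≡ A ++ x ∷ (C ++ s ∷ (A' ++ x ∷ (C' ++ r)))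
  flatten x = trans (++-assoc A (x ∷ C) _) (cong (λ z → A ++ x ∷ (C ++ s ∷ z)) (++-assoc A' (x ∷ C') r))
  cost : ∀ a c a' c' → a + (1 + (c + (1 + (a' + (1 + (a' + (1 + (c + (1 + (a + 1)))))))))) + 2 * c'
                       ≡ 2 * ((a + suc c) + (a' + suc c')) + 2
  cost = solve-∀

data DotView : List Symbol → Set where
  no-dot    : ∀ {V} → All (_≡ Gap) V → DotView V
  first-dot : ∀ {A C} → All (_≡ Gap) A → All Block C → DotView (A ++ Dot ∷ C)

dot-view : ∀ {V} → All Block V → DotView V
dot-view []         = no-dot []
dot-view (dot ∷ bs) = first-dot [] bs
dot-view (gap ∷ bs) with dot-view bs
... | no-dot gs       = no-dot (refl ∷ gs)
... | first-dot gs bC = first-dot (refl ∷ gs) bC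

data Exhausted : List Symbol → List Symbol → Set where
  left-empty  : ∀ {W₁ W₂} → All (_≡ Gap) W₁ → Exhausted W₁ W₂
  right-empty : ∀ {A C W₂} → All (_≡ Gap) A → All Block C → All (_≡ Gap) W₂ → Exhausted (A ++ Dot ∷ C) W₂

record Cancelled (a s : Symbol) (V₁ V₂ l r : List Symbol) : Set where
  constructor cancelled
  field
    rounds    : ℕ
    W₁ W₂     : List Symbol
    blocks₁   : All Block W₁
    blocks₂   : All Block W₂
    length₁   : length W₁ ≡ length V₁
    length₂   : length W₂ ≡ length V₂
    dots₁     : dots V₁ ≡ rounds + dots W₁
    dots₂     : dots V₂ ≡ rounds + dots W₂
    exhausted : Exhausted W₁ W₂
    reaches   : at Seek (a ∷ l) (V₁ ++ s ∷ V₂ ++ r) ⟶⟨ rounds * roundCost (length V₁ + length V₂) ⟩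
                at Seek (a ∷ l) (W₁ ++ s ∷ W₂ ++ r)

cancel : ∀ {a s V₁ V₂} m → dots V₁ ≡ m → Anchor a → Separator s →
         All Block V₁ → All Block V₂ → ∀ l r → Cancelled a s V₁ V₂ l r
cancel m e an sp bs₁ bs₂ l r with dot-view bs₁ | dot-view bs₂
... | no-dot gs₁ | _ =
  cancelled 0 _ _ bs₁ bs₂ refl refl refl refl (left-empty gs₁) idle
... | first-dot gA bC | no-dot gs₂ =
  cancelled 0 _ _ bs₁ bs₂ refl refl refl refl (right-empty gA bC gs₂) idle
... | first-dot {A} {C} gA bC | first-dot {A'} {C'} gA' bC' = by-count m e
  where
  one-more : Cancelled _ _ (A ++ Gap ∷ C) (A' ++ Gap ∷ C') l r → Cancelled _ _ (A ++ Dot ∷ C) (A' ++ Dot ∷ C') l r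
  one-more (cancelled k W₁ W₂ b₁ b₂ len₁ len₂ d₁ d₂ ex rest) =
    cancelled (suc k) W₁ W₂ b₁ b₂ (trans len₁ (length-erase A C)) (trans len₂ (length-erase A' C'))
      (trans (dots-erase A C) (cong suc d₁)) (trans (dots-erase A' C') (cong suc d₂)) ex
      (round an sp gA bC gA' bC' l r ▸ rest
       within ≤-reflexive (cong (λ n → roundCost (length (A ++ Dot ∷ C) + length (A' ++ Dot ∷ C')) + k * roundCost n)
                                (cong₂ _+_ (length-erase A C) (length-erase A' C'))))
  -- The recursion is on the number of Dots of the left region.
  by-count : ∀ m → dots (A ++ Dot ∷ C) ≡ m → Cancelled _ _ (A ++ Dot ∷ C) (A' ++ Dot ∷ C') l r
  by-count zero    e = ⊥-elim (0≢1+n (trans (sym e) (dots-erase A C)))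
  by-count (suc m) e =
    one-more (cancel m (suc-injective (trans (sym (dots-erase A C)) e)) an sp (erased gA bC) (erased gA' bC') l r)

rounds≤ : ∀ {a s V₁ V₂ l r} → All Block V₁ → (c : Cancelled a s V₁ V₂ l r) →
          Cancelled.rounds c ≤ length V₁ + length V₂
rounds≤ {V₁ = V₁} {V₂} bs₁ c =
  ≤-trans (m≤m+n rounds (dots W₁))
  (≤-trans (≤-reflexive (sym dots₁)) (≤-trans (dots≤length bs₁) (m≤m+n (length V₁) (length V₂))))
  where open Cancelled c

-- Adding two collected values

data Orientation : Set where
  low-high high-low : Orientation

mark : Orientation → Symbol
mark low-high = MarkLH
mark high-low = MarkHL

mark-anchor : ∀ o → Anchor (mark o)
mark-anchor low-high = markLH
mark-anchor high-low = markHL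

difference : Orientation → ℕ → ℕ → ℕ
difference low-high a b = b ∸ a
difference high-low a b = a ∸ b

difference-shift : ∀ o m a b → difference o (m + a) (m + b) ≡ difference o a b
difference-shift low-high m a b = [m+n]∸[m+o]≡n∸o m b a
difference-shift high-low m a b = [m+n]∸[m+o]≡n∸o m a b

-- The left region has no Dot left: Seek meets ⊕ and LeftDone returns to the
-- mark, which selects the cleanup.
left-exhausted : ∀ {a W₁ c T} → All (_≡ Gap) W₁ → δ LeftDone a ≡ go c T R → ∀ l X →
  at Seek (a ∷ l) (W₁ ++ Plus ∷ X) ⟶⟨ 2 * length W₁ + 2 ⟩ at c (T ∷ l) (W₁ ++ Plus ∷ X)
left-exhausted {a} {W₁} gs e l X =
  sweepR (over-gaps Seek refl gs) (a ∷ l) (Plus ∷ X)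
  ▸ stepL _ X refl
  ▸ sweepL' (over-gaps LeftDone refl gs) (a ∷ l) (Plus ∷ X)
  ▸ stepR l _ e
  within ≤-reflexive (cost (length W₁))
  where
  cost : ∀ w → w + (1 + (w + 1)) ≡ 2 * w + 2
  cost = solve-∀

-- The right region has no Dot left while the left one has: the first Dot of
-- the left region is erased, SeekR meets the end marker and RightDone returns
-- to the mark.
right-exhausted : ∀ {a A C W₂ c T} → All (_≡ Gap) A → All Block C → All (_≡ Gap) W₂ →
  δ RightDone a ≡ go c T R → ∀ l r →
  at Seek (a ∷ l) ((A ++ Dot ∷ C) ++ Plus ∷ W₂ ++ End ∷ r) ⟶⟨ 2 * (length (A ++ Dot ∷ C) + length W₂) + 4 ⟩
  at c (T ∷ l) ((A ++ Gap ∷ C) ++ Plus ∷ W₂ ++ End ∷ r)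
right-exhausted {a} {A} {C} {W₂} {c} {T} gA bC gs₂ e l r =
  cong (at Seek (a ∷ l)) (++-assoc A (Dot ∷ C) _)
  ≡▸ sweepR (over-gaps Seek refl gA) (a ∷ l) _
  ▸ stepR _ _ refl
  ▸ sweepR (over-blocks ToSep refl refl bC) _ _
  ▸ stepR _ _ refl
  ▸ sweepR (over-gaps SeekR refl gs₂) _ _
  ▸ stepL _ _ refl
  ▸ sweepL' (over-gaps RightDone refl gs₂) _ _
  ▸ stepL _ _ refl
  ▸ sweepL' (over-blocks RightDone refl refl bC) _ _
  ▸ stepL _ _ refl
  ▸ sweepL' (over-gaps RightDone refl gA) (a ∷ l) _
  ▸ stepR l _ e
  ▸≡ cong (at c (T ∷ l)) (sym (++-assoc A (Gap ∷ C) _))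
  within ≤-reflexive (trans (cost (length A) (length C) (length W₂))
                            (cong (λ m → 2 * (m + length W₂) + 4) (sym (length-++ A))))
  where
  cost : ∀ a c w → a + (1 + (c + (1 + (w + (1 + (w + (1 + (c + (1 + (a + 1))))))))))
                   ≡ 2 * ((a + suc c) + w) + 4
  cost = solve-∀

left-cost : ∀ a b → (2 * a + 2) + (a + b + 2) ≤ 3 * (a + b) + 6
left-cost a b = ≤-by (2 * b + 2) (cost a b)
  where
  cost : ∀ a b → (2 * a + 2) + (a + b + 2) + (2 * b + 2) ≡ 3 * (a + b) + 6
  cost = solve-∀

right-cost : ∀ (A C W₂ : List Symbol) →
  2 * (length (A ++ Dot ∷ C) + length W₂) + 4 + (length (A ++ Gap ∷ C) + length W₂ + 2)
  ≡ 3 * (length (A ++ Dot ∷ C) + length W₂) + 6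
right-cost A C W₂ rewrite length-erase A C = cost (length (A ++ Dot ∷ C)) (length W₂)
  where
  cost : ∀ a b → 2 * (a + b) + 4 + (a + b + 2) ≡ 3 * (a + b) + 6
  cost = solve-∀

subtract-finish : ∀ o {W₁ W₂} → Exhausted W₁ W₂ → All Block W₁ → All Block W₂ → ∀ l r →
  Produces (at Seek (mark o ∷ l) (W₁ ++ Plus ∷ W₂ ++ End ∷ r)) (3 * (length W₁ + length W₂) + 6)
           (high , difference o (dots W₁) (dots W₂)) (length W₁ + length W₂ + 2) l r
subtract-finish low-high {W₁} {W₂} (left-empty gs₁) bs₁ bs₂ l r =
  produces-≤ (produces-value (cong (high ,_) (absorbed (dots-gaps gs₁)))
               (left-exhausted gs₁ refl l (W₂ ++ End ∷ r) ▸ₚ keep-phase hi₀ bs₁ bs₂ l r))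
             (left-cost (length W₁) (length W₂))
  where
  absorbed : dots W₁ ≡ 0 → dots W₁ + dots W₂ ≡ dots W₂ ∸ dots W₁
  absorbed e rewrite e = refl
subtract-finish low-high {W₂ = W₂} (right-empty {A} {C} gA bC gs₂) bs₁ bs₂ l r =
  produces-≤ (produces-value (cong (high ,_) (sym (trans (cong (_∸ dots (A ++ Dot ∷ C)) (dots-gaps gs₂)) (0∸n≡0 (dots (A ++ Dot ∷ C))))))
               (produces-size (cong (λ n → n + length W₂ + 2) (length-erase A C))
                 (right-exhausted gA bC gs₂ refl l r ▸ₚ wipe-phase hi₀ (erased gA bC) bs₂ l r)))
             (≤-reflexive (right-cost A C W₂))
subtract-finish high-low {W₁} {W₂} (left-empty gs₁) bs₁ bs₂ l r =
  produces-≤ (produces-value (cong (high ,_) (sym (trans (cong (_∸ dots W₂) (dots-gaps gs₁)) (0∸n≡0 (dots W₂)))))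
               (left-exhausted gs₁ refl l (W₂ ++ End ∷ r) ▸ₚ wipe-phase hi₀ bs₁ bs₂ l r))
             (left-cost (length W₁) (length W₂))
subtract-finish high-low {W₂ = W₂} (right-empty {A} {C} gA bC gs₂) bs₁ bs₂ l r =
  produces-≤ (produces-value (cong (high ,_) restored)
               (produces-size (cong (λ n → n + length W₂ + 2) (length-erase A C))
                 (right-exhausted gA bC gs₂ refl l r ▸ₚ keep-phase hi₁ (erased gA bC) bs₂ l r)))
             (≤-reflexive (right-cost A C W₂))
  where
  restored : 1 + (dots (A ++ Gap ∷ C) + dots W₂) ≡ dots (A ++ Dot ∷ C) ∸ dots W₂
  restored rewrite dots-gaps gs₂ | dots-erase A C = cong suc (+-identityʳ _)


subtractCost : ℕ → ℕ
subtractCost n = n * roundCost n + (3 * n + 6)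

subtract-phase : ∀ o {V₁ V₂} → All Block V₁ → All Block V₂ → ∀ l r →
  Produces (at Seek (mark o ∷ l) (V₁ ++ Plus ∷ V₂ ++ End ∷ r)) (subtractCost (length V₁ + length V₂))
           (high , difference o (dots V₁) (dots V₂)) (length V₁ + length V₂ + 2) l r
subtract-phase o {V₁} {V₂} bs₁ bs₂ l r = finish (cancel (dots V₁) refl (mark-anchor o) plus bs₁ bs₂ l (End ∷ r))
  where
  n : ℕ
  n = length V₁ + length V₂
  finish : Cancelled (mark o) Plus V₁ V₂ l (End ∷ r) → Produces _ (subtractCost n) _ (n + 2) l r
  finish c@(cancelled k W₁ W₂ b₁ b₂ len₁ len₂ d₁ d₂ ex rest) =
    produces-≤ (rest ▸ₚ produces-value shifted
                 (subst (λ m → Produces (at Seek (mark o ∷ l) (W₁ ++ Plus ∷ W₂ ++ End ∷ r)) (3 * m + 6)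
                                        (high , difference o (dots W₁) (dots W₂)) (m + 2) l r)
                        (cong₂ _+_ len₁ len₂)
                   (subtract-finish o ex b₁ b₂ l r)))
               (+-monoˡ-≤ (3 * n + 6) (*-monoˡ-≤ (roundCost n) (rounds≤ bs₁ c)))
    where
    shifted : (high , difference o (dots W₁) (dots W₂)) ≡ (high , difference o (dots V₁) (dots V₂))
    shifted = cong (high ,_) (trans (sym (difference-shift o k (dots W₁) (dots W₂)))
                                    (sym (cong₂ (difference o) d₁ d₂)))

merge≤subtract : ∀ n → n + 2 ≤ subtractCost n
merge≤subtract n = ≤-trans (≤-by (2 * n + 4) (cost n)) (m≤n+m (3 * n + 6) (n * roundCost n))
  where
  cost : ∀ n → n + 2 + (2 * n + 4) ≡ 3 * n + 6
  cost = solve-∀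

-- At "(", with both kinds known: equal kinds are merged (low values keep
-- their Dots, high values saturate), different kinds are subtracted.
add-phase : ∀ κ₁ κ₂ {V₁ V₂} → All Block V₁ → All Block V₂ → ∀ l r →
  Produces (at (decide κ₁ κ₂) l (LPar ∷ V₁ ++ Plus ∷ V₂ ++ End ∷ r)) (suc (subtractCost (length V₁ + length V₂)))
           ((κ₁ , dots V₁) ⊞ (κ₂ , dots V₂)) (length V₁ + length V₂ + 2) l r
add-phase low  low  {V₁} {V₂} bs₁ bs₂ l r =
  produces-≤ (stepR l _ refl ▸ₚ keep-phase lo₀ bs₁ bs₂ l r) (s≤s (merge≤subtract (length V₁ + length V₂)))
add-phase high high {V₁} {V₂} bs₁ bs₂ l r =
  produces-≤ (stepR l _ refl ▸ₚ wipe-phase hi₀ bs₁ bs₂ l r) (s≤s (merge≤subtract (length V₁ + length V₂)))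
add-phase low  high bs₁ bs₂ l r = stepR l _ refl ▸ₚ subtract-phase low-high bs₁ bs₂ l r
add-phase high low  bs₁ bs₂ l r = stepR l _ refl ▸ₚ subtract-phase high-low bs₁ bs₂ l r

combine-phase : ∀ {v₁ t₁ B₁ v₂ t₂ B₂} → Stores v₁ t₁ B₁ → Stores v₂ t₂ B₂ → ∀ l r →
  Produces (at Scan (B₂ ++ t₂ ∷ Plus ∷ B₁ ++ t₁ ∷ LPar ∷ l) (RPar ∷ r)) (phaseCost (length B₁ + length B₂ + 5))
           (v₁ ⊞ v₂) (length B₁ + length B₂ + 4) l r
combine-phase {t₁ = t₁} {B₁} {t₂ = t₂} {B₂} st₁@(stores {κ₁} tg₁ bs₁ refl) st₂@(stores {κ₂} tg₂ bs₂ refl) l r =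
  produces-≤ (produces-size sizes (produces-value values
               (collect-phase refl plus st₁ st₂ (LPar ∷ l) r
                ▸ₚ add-phase κ₁ κ₂ (region-blocks tg₁ bs₁) (region-blocks tg₂ bs₂) l r)))
             (subst (λ m → length B₁ + length B₂ + 4 + suc (subtractCost m) ≤ phaseCost (length B₁ + length B₂ + 5))
                    (sym regions) (≤-by (6 * (length B₁ + length B₂) + 21) (cost (length B₁) (length B₂))))
  where
  regions : length (region t₁ B₁) + length (region t₂ B₂) ≡ suc (length B₁) + suc (length B₂)
  regions = cong₂ _+_ (length-region t₁ B₁) (length-region t₂ B₂)
  values : (κ₁ , dots (region t₁ B₁)) ⊞ (κ₂ , dots (region t₂ B₂)) ≡ (κ₁ , _ + dots B₁) ⊞ (κ₂ , _ + dots B₂)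
  values = cong₂ (λ a b → (κ₁ , a) ⊞ (κ₂ , b)) (region-dots B₁ tg₁) (region-dots B₂ tg₂)
  sizes : length (region t₁ B₁) + length (region t₂ B₂) + 2 ≡ length B₁ + length B₂ + 4
  sizes = trans (cong (λ m → m + 2) regions) (shape (length B₁) (length B₂))
    where
    shape : ∀ a b → suc a + suc b + 2 ≡ a + b + 4
    shape = solve-∀
  cost : ∀ a b → a + b + 4 + suc ((suc a + suc b) * (2 * (suc a + suc b) + 2) + (3 * (suc a + suc b) + 6))
                 + (6 * (a + b) + 21) ≡ 2 * (a + b + 5) * (a + b + 5)
  cost = solve-∀

-- Comparing the two values at the end of the input

-- Exhausted regions have equal counts iff both ran out: Check accepts iff it
-- finds no Dot right of the separator.
compare-exhausted : ∀ {W₁ W₂} → Exhausted W₁ W₂ → All Block W₂ →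
  Decides (at Seek (Blank ∷ []) (W₁ ++ Sep ∷ W₂ ++ Blank ∷ [])) (length W₁ + length W₂ + 2) (dots W₁ ≡ dots W₂)
compare-exhausted {W₁} (left-empty gs₁) bs₂ with dot-view bs₂
... | no-dot {W₂} gs₂ =
  decides true
    (sweepR (over-gaps Seek refl gs₁) (Blank ∷ []) _
     ▸ stepR _ _ refl
     ▸ sweepR (over-gaps Check refl gs₂) _ (Blank ∷ [])
     ▸ₕ stepH _ [] refl
     withinₕ ≤-reflexive (cost (length W₁) (length W₂)))
    (mk⇔ (λ _ → trans (dots-gaps gs₁) (sym (dots-gaps gs₂))) (λ _ → tt))
  where
  cost : ∀ a b → a + (1 + b) + 1 ≡ a + b + 2
  cost = solve-∀
... | first-dot {A'} {C'} gA' bC' =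
  decides false
    (cong (λ z → at Seek (Blank ∷ []) (W₁ ++ Sep ∷ z)) (++-assoc A' (Dot ∷ C') _)
     ≡▸ sweepR (over-gaps Seek refl gs₁) (Blank ∷ []) _
     ▸ stepR _ _ refl
     ▸ sweepR (over-gaps Check refl gA') _ _
     ▸ₕ stepH _ _ refl
     withinₕ ≤-trans (≤-by (suc (length C')) (cost (length W₁) (length A') (length C')))
                     (≤-reflexive (cong (λ m → length W₁ + m + 2) (sym (length-++ A')))))
    (mk⇔ (λ ()) (λ e → ⊥-elim (0≢1+n (trans (sym (dots-gaps gs₁)) (trans e (dots-erase A' C'))))))
  where
  cost : ∀ a b c → a + (1 + b) + 1 + suc c ≡ a + (b + suc c) + 2
  cost = solve-∀
compare-exhausted (right-empty {A} {C} {W₂} gA bC gs₂) bs₂ =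
  decides false
    (cong (at Seek (Blank ∷ [])) (++-assoc A (Dot ∷ C) _)
     ≡▸ sweepR (over-gaps Seek refl gA) (Blank ∷ []) _
     ▸ stepR _ _ refl
     ▸ sweepR (over-blocks ToSep refl refl bC) _ _
     ▸ stepR _ _ refl
     ▸ sweepR (over-gaps SeekR refl gs₂) _ (Blank ∷ [])
     ▸ₕ stepH _ [] refl
     withinₕ ≤-reflexive (trans (cost (length A) (length C) (length W₂))
                                (cong (λ m → m + length W₂ + 2) (sym (length-++ A)))))
    (mk⇔ (λ ()) (λ e → ⊥-elim (0≢1+n (trans (sym (dots-gaps gs₂)) (trans (sym e) (dots-erase A C))))))
  where
  cost : ∀ a c w → a + (1 + (c + (1 + w))) + 1 ≡ a + suc c + w + 2
  cost = solve-∀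

compare-counts : ∀ {V₁ V₂} → All Block V₁ → All Block V₂ →
  Decides (at Seek (Blank ∷ []) (V₁ ++ Sep ∷ V₂ ++ Blank ∷ []))
          ((length V₁ + length V₂) * roundCost (length V₁ + length V₂) + (length V₁ + length V₂ + 2))
          (dots V₁ ≡ dots V₂)
compare-counts {V₁} {V₂} bs₁ bs₂ = finish (cancel (dots V₁) refl blank sep bs₁ bs₂ [] (Blank ∷ []))
  where
  n : ℕ
  n = length V₁ + length V₂
  finish : Cancelled Blank Sep V₁ V₂ [] (Blank ∷ []) → Decides _ (n * roundCost n + (n + 2)) (dots V₁ ≡ dots V₂)
  finish c@(cancelled k W₁ W₂ b₁ b₂ len₁ len₂ d₁ d₂ ex rest) =
    decides-≤ (rest ▸ᵈ decides-⇔ shifted (compare-exhausted ex b₂))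
              (+-mono-≤ (*-monoˡ-≤ (roundCost n) (rounds≤ bs₁ c))
                        (≤-reflexive (cong (λ m → m + 2) (cong₂ _+_ len₁ len₂))))
    where
    shifted : (dots W₁ ≡ dots W₂) ⇔ (dots V₁ ≡ dots V₂)
    shifted = mk⇔ (λ e → trans d₁ (trans (cong (λ m → k + m) e) (sym d₂)))
                  (λ e → +-cancelˡ-≡ k _ _ (trans (sym d₁) (trans e d₂)))

same-kind : ∀ {κ : Kind} {a b : ℕ} → (a ≡ b) ⇔ ((κ , a) ≡ (κ , b))
same-kind = mk⇔ (cong (_ ,_)) (cong proj₂)

compare-kinds : ∀ κ₁ κ₂ {V₁ V₂} → All Block V₁ → All Block V₂ →
  Decides (atLeft (decide κ₁ κ₂) [] (V₁ ++ Sep ∷ V₂ ++ Blank ∷ []))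
          (suc ((length V₁ + length V₂) * roundCost (length V₁ + length V₂) + (length V₁ + length V₂ + 2)))
          ((κ₁ , dots V₁) ≡ (κ₂ , dots V₂))
compare-kinds low  low  bs₁ bs₂ = stepR [] _ refl ▸ᵈ decides-⇔ same-kind (compare-counts bs₁ bs₂)
compare-kinds high high bs₁ bs₂ = stepR [] _ refl ▸ᵈ decides-⇔ same-kind (compare-counts bs₁ bs₂)
compare-kinds low  high bs₁ bs₂ = decides false (stepH [] _ refl withinₕ s≤s z≤n) (mk⇔ (λ ()) (λ ()))
compare-kinds high low  bs₁ bs₂ = decides false (stepH [] _ refl withinₕ s≤s z≤n) (mk⇔ (λ ()) (λ ()))

compareCost : ℕ → ℕ
compareCost n = n * roundCost n + 2 * n + 5

compare-phase : ∀ {v₁ t₁ B₁ v₂ t₂ B₂} → Stores v₁ t₁ B₁ → Stores v₂ t₂ B₂ →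
  Decides (at Scan (B₂ ++ t₂ ∷ Sep ∷ B₁ ++ t₁ ∷ []) []) (compareCost (suc (length B₁) + suc (length B₂))) (v₁ ≡ v₂)
compare-phase {t₁ = t₁} {B₁} {t₂ = t₂} {B₂} st₁@(stores {κ₁} tg₁ bs₁ refl) st₂@(stores {κ₂} tg₂ bs₂ refl) =
  decides-≤ (decides-⇔ values
              (collect-phase refl sep st₁ st₂ [] []
               ▸ᵈ compare-kinds κ₁ κ₂ (region-blocks tg₁ bs₁) (region-blocks tg₂ bs₂)))
            (≤-reflexive (trans (cong (λ m → length B₁ + length B₂ + 4 + suc (m * roundCost m + (m + 2))) regions)
                                (cost (length B₁) (length B₂))))
  where
  regions : length (region t₁ B₁) + length (region t₂ B₂) ≡ suc (length B₁) + suc (length B₂)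
  regions = cong₂ _+_ (length-region t₁ B₁) (length-region t₂ B₂)
  values : ((κ₁ , dots (region t₁ B₁)) ≡ (κ₂ , dots (region t₂ B₂))) ⇔ (_ ≡ _)
  values rewrite region-dots B₁ tg₁ | region-dots B₂ tg₂ = mk⇔ (λ e → e) (λ e → e)
  cost : ∀ a b → a + b + 4 + suc ((suc a + suc b) * (2 * (suc a + suc b) + 2) + (suc a + suc b + 2))
                 ≡ (suc a + suc b) * (2 * (suc a + suc b) + 2) + 2 * (suc a + suc b) + 5
  cost = solve-∀

-- Evaluating a formula

cells : Formula → List Symbol → List Symbol
cells 𝟎        r = Lo₀ ∷ r
cells 𝕏        r = Lo₁ ∷ r
cells (φ ⋆)    r = cells φ (Star ∷ r)
cells (φ ⊕f ψ) r = LPar ∷ cells φ (Plus ∷ cells ψ (RPar ∷ r))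

-- The length of the block holding the value of φ (one less than ‖ φ ‖).
width : Formula → ℕ
width 𝟎        = 0
width 𝕏        = 0
width (φ ⋆)    = suc (width φ)
width (φ ⊕f ψ) = width φ + width ψ + 4

phaseCost-mono : ∀ {m n} → m ≤ n → phaseCost m ≤ phaseCost n
phaseCost-mono p = *-mono-≤ (*-mono-≤ (≤-refl {2}) p) p

then-star : ∀ {c k v w l r} → Produces c k v w l (Star ∷ r) →
            Produces c (k + phaseCost (w + 2)) (starV v) (suc w) l r
then-star {l = l} {r} (produces t B st refl p) = p ▸ₚ star-phase st l r

then-⊕ : ∀ {l Y X r k₁ k₂ v₁ v₂ w₁ w₂} →
  Produces (at Scan (LPar ∷ l) Y) k₁ v₁ w₁ (LPar ∷ l) (Plus ∷ X) →
  (∀ l' → Produces (at Scan l' X) k₂ v₂ w₂ l' (RPar ∷ r)) →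
  Produces (at Scan l (LPar ∷ Y)) (1 + (k₁ + (1 + (k₂ + phaseCost (w₁ + w₂ + 5))))) (v₁ ⊞ v₂) (w₁ + w₂ + 4) l r
then-⊕ {l} {r = r} (produces t₁ B₁ st₁ refl p₁) second with second (Plus ∷ B₁ ++ t₁ ∷ LPar ∷ l)
... | produces t₂ B₂ st₂ refl p₂ = stepR l _ refl ▸ₚ p₁ ▸ₚ stepR _ _ refl ▸ₚ p₂ ▸ₚ combine-phase st₁ st₂ l r

phaseCost-positive : ∀ {m n} → suc m ≤ n → 1 ≤ phaseCost n
phaseCost-positive {n = suc n} _ = s≤s z≤n

plus-cost : ∀ a b W {P} → P ≤ W → 1 ≤ W → 1 + (suc a * W + (1 + (suc b * W + P))) ≤ suc (a + b + 4) * W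
plus-cost a b (suc W) P≤W _ =
  ≤-trans (+-monoʳ-≤ 1 (+-monoʳ-≤ (suc a * suc W) (+-monoʳ-≤ 1 (+-monoʳ-≤ (suc b * suc W) P≤W))))
          (≤-by (2 * W) (cost a b W))
  where
  cost : ∀ a b W → 1 + (suc a * suc W + (1 + (suc b * suc W + suc W))) + 2 * W ≡ suc (a + b + 4) * suc W
  cost = solve-∀

-- Evaluation runs in time ‖ φ ‖ · phaseCost G for any G ≥ ‖ φ ‖: one step per
-- leaf and at most one phase per operator.
evaluate : ∀ {G} φ → suc (width φ) ≤ G → ∀ l r →
  Produces (at Scan l (cells φ r)) (suc (width φ) * phaseCost G) (eval φ) (width φ) l r
evaluate 𝟎 (s≤s _) l r = produces Lo₀ [] (stores lo₀ [] refl) refl (stepR l r refl within s≤s z≤n)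
evaluate 𝕏 (s≤s _) l r = produces Lo₁ [] (stores lo₁ [] refl) refl (stepR l r refl within s≤s z≤n)
evaluate {G} (φ ⋆) le l r =
  produces-≤ (then-star (evaluate φ (≤-trans (n≤1+n _) le) l (Star ∷ r)))
             (≤-trans (+-monoʳ-≤ (suc w * phaseCost G) (phaseCost-mono (≤-trans (≤-reflexive (+-comm w 2)) le)))
                      (≤-reflexive (+-comm (suc w * phaseCost G) (phaseCost G))))
  where
  w : ℕ
  w = width φ
evaluate {G} (φ ⊕f ψ) le l r =
  produces-≤ (then-⊕ (evaluate φ (≤-trans (s≤s (m≤m+n (width φ) (width ψ + 4))) le') (LPar ∷ l) _)
                     (λ l' → evaluate ψ (≤-trans (s≤s (m≤n+m (width ψ) (width φ))) (≤-trans (s≤s (m≤m+n _ 4)) le)) l' (RPar ∷ r)))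
             (plus-cost (width φ) (width ψ) (phaseCost G) (phaseCost-mono (≤-trans (≤-reflexive (+-suc (width φ + width ψ) 4)) le)) (phaseCost-positive le))
  where
  le' : suc (width φ + (width ψ + 4)) ≤ G
  le' = ≤-trans (≤-reflexive (cong suc (sym (+-assoc (width φ) (width ψ) 4)))) le

-- The input and the time bound

map-cell-++ : ∀ xs ys r → map cell (xs ++ ys) ++ r ≡ map cell xs ++ (map cell ys ++ r)
map-cell-++ xs ys r = trans (cong (_++ r) (map-++ cell xs ys)) (++-assoc (map cell xs) (map cell ys) r)

cells-correct : ∀ φ r → map cell (str φ) ++ r ≡ cells φ r
cells-correct 𝟎 r = refl
cells-correct 𝕏 r = refl
cells-correct (φ ⋆) r = trans (map-cell-++ (str φ) [ sStar ] r) (cells-correct φ (Star ∷ r))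
cells-correct (φ ⊕f ψ) r = cong (LPar ∷_) (begin
  map cell (str φ ++ sOplus ∷ str ψ ++ [ sRpar ]) ++ r
    ≡⟨ map-cell-++ (str φ) _ r ⟩
  map cell (str φ) ++ Plus ∷ map cell (str ψ ++ [ sRpar ]) ++ r
    ≡⟨ cong (λ z → map cell (str φ) ++ Plus ∷ z) (trans (map-cell-++ (str ψ) [ sRpar ] r) (cells-correct ψ (RPar ∷ r))) ⟩
  map cell (str φ) ++ Plus ∷ cells ψ (RPar ∷ r)
    ≡⟨ cells-correct φ _ ⟩
  cells φ (Plus ∷ cells ψ (RPar ∷ r)) ∎)
  where open ≡-Reasoning

input-tape : ∀ φ ψ → initial machine (input φ ψ) ≡ at Scan [] (cells φ (Sep ∷ cells ψ []))
input-tape φ ψ = trans (initial-tape (input φ ψ)) (cong (at Scan []) (begin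
  map inSymbol (map formulaSym (str φ) ++ sep ∷ map formulaSym (str ψ))
    ≡⟨ map-++ inSymbol (map formulaSym (str φ)) _ ⟩
  map inSymbol (map formulaSym (str φ)) ++ Sep ∷ map inSymbol (map formulaSym (str ψ))
    ≡⟨ cong₂ (λ a b → a ++ Sep ∷ b) (sym (map-∘ {g = inSymbol} {f = formulaSym} (str φ)))
                                    (sym (map-∘ {g = inSymbol} {f = formulaSym} (str ψ))) ⟩
  map cell (str φ) ++ Sep ∷ map cell (str ψ)
    ≡⟨ cong (λ z → map cell (str φ) ++ Sep ∷ z) (trans (sym (++-identityʳ _)) (cells-correct ψ [])) ⟩
  map cell (str φ) ++ Sep ∷ cells ψ []
    ≡⟨ cells-correct φ _ ⟩
  cells φ (Sep ∷ cells ψ []) ∎))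
  where
  open ≡-Reasoning
  initial-tape : ∀ xs → initial machine xs ≡ at Scan [] (map inSymbol xs)
  initial-tape []      = refl
  initial-tape (x ∷ xs) = refl

size-width : ∀ φ → ‖ φ ‖ ≡ suc (width φ)
size-width 𝟎 = refl
size-width 𝕏 = refl
size-width (φ ⋆) = trans (length-++ (str φ)) (trans (cong (λ n → n + 1) (size-width φ)) (+-comm (suc (width φ)) 1))
size-width (φ ⊕f ψ) = cong suc (begin
  length (str φ ++ sOplus ∷ str ψ ++ [ sRpar ])  ≡⟨ length-++ (str φ) ⟩
  ‖ φ ‖ + suc (length (str ψ ++ [ sRpar ]))     ≡⟨ cong (λ n → ‖ φ ‖ + suc n) (length-++ (str ψ)) ⟩
  ‖ φ ‖ + suc (‖ ψ ‖ + 1)                       ≡⟨ cong₂ (λ a b → a + suc (b + 1)) (size-width φ) (size-width ψ) ⟩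
  suc (width φ) + suc (suc (width ψ) + 1)       ≡⟨ shape (width φ) (width ψ) ⟩
  width φ + width ψ + 4                         ∎)
  where
  open ≡-Reasoning
  shape : ∀ a b → suc a + suc (suc b + 1) ≡ a + b + 4
  shape = solve-∀

then-compare : ∀ {c k₁ k₂ v₁ v₂ w₁ w₂ X} →
  Produces c k₁ v₁ w₁ [] (Sep ∷ X) → (∀ l' → Produces (at Scan l' X) k₂ v₂ w₂ l' []) →
  Decides c (k₁ + (1 + (k₂ + compareCost (suc w₁ + suc w₂)))) (v₁ ≡ v₂)
then-compare (produces t₁ B₁ st₁ refl p₁) second with second (Sep ∷ B₁ ++ t₁ ∷ [])
... | produces t₂ B₂ st₂ refl p₂ = p₁ ▸ᵈ stepR _ _ refl ▸ᵈ p₂ ▸ᵈ compare-phase st₁ st₂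

polynomial : Poly
polynomial = 6 ∷ 4 ∷ 2 ∷ 2 ∷ []

total-cost : ∀ x y → x * phaseCost (x + y) + (1 + (y * phaseCost (x + y) + compareCost (x + y)))
                     ≡ evalPoly polynomial (x + y)
total-cost = cost
  where
  cost : ∀ x y → x * (2 * (x + y) * (x + y)) + (1 + (y * (2 * (x + y) * (x + y))
                   + ((x + y) * (2 * (x + y) + 2) + 2 * (x + y) + 5)))
                 ≡ 6 + (x + y) * (4 + (x + y) * (2 + (x + y) * (2 + (x + y) * 0)))
  cost = solve-∀

decide-formulas : ∀ φ ψ → Decides (initial machine (input φ ψ)) (evalPoly polynomial (‖ φ ‖ + ‖ ψ ‖)) (⟦ φ ⟧ ≡ ⟦ ψ ⟧)
decide-formulas φ ψ =
  subst₂ (λ c n → Decides c (evalPoly polynomial n) (⟦ φ ⟧ ≡ ⟦ ψ ⟧))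
         (sym (input-tape φ ψ)) (sym (cong₂ _+_ (size-width φ) (size-width ψ)))
         (decides-⇔ meaning
           (decides-≤ (then-compare (evaluate {n} φ (m≤m+n _ _) [] _) (λ l' → evaluate {n} ψ (m≤n+m _ (suc (width φ))) l' []))
                      (≤-reflexive (total-cost (suc (width φ)) (suc (width ψ))))))
  where
  n : ℕ
  n = suc (width φ) + suc (width ψ)
  meaning : (eval φ ≡ eval ψ) ⇔ (⟦ φ ⟧ ≡ ⟦ ψ ⟧)
  meaning = mk⇔ (λ e → trans (sym (eval-correct φ)) (trans (cong value e) (eval-correct ψ)))
                (λ e → value-injective (trans (eval-correct φ) (trans e (sym (eval-correct ψ)))))

theorem6p1 : Σ Poly λ P → Σ TM λ M → (φ ψ : Formula) →
    Σ Bool λ b →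
    (run M (evalPoly P (‖ φ ‖ + ‖ ψ ‖)) (initial M (input φ ψ)) ≡ just b)
    × (T b ⇔ (⟦ φ ⟧ ≡ ⟦ ψ ⟧))
theorem6p1 = polynomial , machine , λ φ ψ → verdict (decide-formulas φ ψ)
  where
  verdict : ∀ {c k P} → Decides c k P → Σ Bool λ b → (run machine k c ≡ just b) × (T b ⇔ P)
  verdict (decides b h ok) = b , run-budget h ≤-refl , ok
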